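{- The generating function $f_i(x,y)=\sum_{n,m\ge 0}(n,m)_i\, x^n y^m$ of the $i$th tier binomial coefficients is given by \[ f_i(x,y)= \frac{1}{i+1-x-y}\cdot\frac{\binom{i-x}{i}}{\binom{i-x-y}{i}},\quad i\ge 0. \]
   Context: The tier-$i$ binomial coefficients $(n,m)_i$ ($i\ge0$, $n,m\ge0$) are the rational numbers determined by the recurrence $(n,m)_i=\frac{(n-1,m)_i}{i+1}+\frac1{i+1}\sum_{j=0}^i(n,m-1)_j$ for $n,m>0$, with initial values $(0,m)_i=\frac1{i+1}\zeta^{\star}_{i+1}(\{1\}_m)$ and $(n,0)_i=(i+1)^{ -n-1}$, where $\zeta^{\star}_n(\{1\}_k)=\sum_{n\ge\ell_1\ge\cdots\ge\ell_k\ge1}(\ell_1\cdots\ell_k)^{ -1}$. (They are the rational coefficients in the expansion of $S_{n,m}^{(i)}=\frac{(-1)^{n+m}}{n!m!}\int_0^1x^i\ln^n x\ln^m(1-x)dx$ into multiple zeta values $\zeta(a+1,\{1\}_{b-1})$.) -}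

module Defs where

open import Data.Nat as ℕ using (ℕ; zero; suc; _∸_)
open import Data.Integer using (+_)
open import Data.Rational using (ℚ; 0ℚ; 1ℚ; _+_; _*_; _-_; _/_)

sumLt : ℕ → (ℕ → ℚ) → ℚ
sumLt zero    f = 0ℚ
sumLt (suc k) f = sumLt k f + f k

prodLt : ℕ → (ℕ → ℚ) → ℚ
prodLt zero    f = 1ℚ
prodLt (suc k) f = prodLt k f * f k

nat : ℕ → ℚ
nat k = + k / 1

inv1+ : ℕ → ℚ
inv1+ i = + 1 / suc i

powQ : ℚ → ℕ → ℚ
powQ q zero    = 1ℚ
powQ q (suc n) = powQ q n * q

-- ζ*_N({1}_k) = Σ_{N ≥ ℓ₁ ≥ ⋯ ≥ ℓ_k ≥ 1} (ℓ₁⋯ℓ_k)⁻¹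
-- computed recursively: ζ*_N({1}_0) = 1,
-- ζ*_N({1}_{k+1}) = Σ_{ℓ=1}^{N} ℓ⁻¹ ζ*_ℓ({1}_k)
zetaStar1 : ℕ → ℕ → ℚ
zetaStar1 N zero    = 1ℚ
zetaStar1 N (suc k) = sumLt N (λ l → inv1+ l * zetaStar1 (suc l) k)

-- tierRow m i n = (n,m)_i
tierRow : ℕ → ℕ → ℕ → ℚ
tierRow zero    i n       = powQ (inv1+ i) (suc n)
tierRow (suc m) i zero    = inv1+ i * zetaStar1 (suc i) (suc m)
tierRow (suc m) i (suc n) =
  tierRow (suc m) i n * inv1+ i
  + inv1+ i * sumLt (suc i) (λ j → tierRow m j (suc n))

tierBinom : ℕ → ℕ → ℕ → ℚ
tierBinom i n m = tierRow m i n

-- Formal power series in two variables x, y over ℚ: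
-- a series is its coefficient function  s n m = [x^n y^m] s.

Series : Set
Series = ℕ → ℕ → ℚ

constS : ℚ → Series
constS c zero zero = c
constS c _    _    = 0ℚ

X : Series
X (suc zero) zero = 1ℚ
X _          _    = 0ℚ

Y : Series
Y zero (suc zero) = 1ℚ
Y _    _          = 0ℚ

_⊕_ : Series → Series → Series
(f ⊕ g) n m = f n m + g n m

_⊖_ : Series → Series → Series
(f ⊖ g) n m = f n m - g n m

scaleS : ℚ → Series → Series
scaleS c f n m = c * f n m

_⊛_ : Series → Series → Series
(f ⊛ g) n m = sumLt (suc n) (λ a → sumLt (suc m) (λ b → f a b * g (n ∸ a) (m ∸ b)))

infixl 7 _⊛_
infixl 6 _⊕_ _⊖_

prodS : ℕ → (ℕ → Series) → Series
prodS zero    F = constS 1ℚ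
prodS (suc k) F = prodS k F ⊛ F k

invFact : ℕ → ℚ
invFact k = prodLt k inv1+

binomS : Series → ℕ → Series
binomS a i = scaleS (invFact i) (prodS i (λ j → a ⊖ constS (nat j)))

genF : ℕ → Series
genF i n m = tierBinom i n m

module Submission where

-- Write f_k = Σ (n,m)_k x^n y^m and g_k = f_0 + ⋯ + f_{k-1}.  Reading the
-- recurrence and the initial values of (n,m)_k coefficientwise gives the
-- single identity of power series
--     (k+1-x) f_k = 1 + y g_{k+1}                         (TierRecurrence).
-- The theorem is a consequence of this identity valid in every commutative
-- ring (FallingFactorialIdentity): subtracting y f_k gives
-- (k+1-x-y) f_k = 1 + y g_k, and an induction on k shows
--     falling (k-x-y) k · (1 + y g_k) = falling (k-x) k,
-- where falling a k = a (a-1) ⋯ (a-k+1).  Dividing both falling factorials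
-- by k! turns them into the binomial series of the statement.

open import Defs
open import Data.Nat using (ℕ; suc)
open import Relation.Binary.PropositionalEquality using (_≡_)
open import Data.Nat using (zero; _∸_)
open import Data.Product using (_,_)
open import Algebra.Bundles using (CommutativeMonoid; CommutativeRing)

module BigOperator {a ℓ} (M : CommutativeMonoid a ℓ) where
  open CommutativeMonoid M

  big< : ℕ → (ℕ → Carrier) → Carrier
  big< zero    f = ε
  big< (suc k) f = big< k f ∙ f k

  big-cong : ∀ k {f g : ℕ → Carrier} → (∀ j → f j ≈ g j) → big< k f ≈ big< k g
  big-cong zero    f≈g = refl
  big-cong (suc k) f≈g = ∙-cong (big-cong k f≈g) (f≈g k)

  -- Splitting off the first factor; this is what lets us recurse on the
  -- index set {0,…,k} ↦ {1,…,k}.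
  big-head : ∀ k (f : ℕ → Carrier) → big< (suc k) f ≈ f 0 ∙ big< k (λ j → f (suc j))
  big-head zero    f = trans (identityˡ (f 0)) (sym (identityʳ (f 0)))
  big-head (suc k) f = trans (∙-cong (big-head k f) refl) (assoc _ _ _)

  big-ε : ∀ k → big< k (λ _ → ε) ≈ ε
  big-ε zero    = refl
  big-ε (suc k) = trans (identityʳ _) (big-ε k)

  big-∙ : ∀ k (f g : ℕ → Carrier) → big< k (λ j → f j ∙ g j) ≈ big< k f ∙ big< k g
  big-∙ zero    f g = sym (identityˡ ε)
  big-∙ (suc k) f g = trans (∙-cong (big-∙ k f g) refl) (interchange _ _ _ _)
    where open import Algebra.Properties.CommutativeSemigroup commutativeSemigroup using (interchange)

module RingBigOperators {c ℓ} (R : CommutativeRing c ℓ) where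
  open CommutativeRing R
  open BigOperator +-commutativeMonoid public
    renaming (big< to Σ<; big-cong to Σ-cong; big-head to Σ-head; big-ε to Σ-zero; big-∙ to Σ-+)
  open BigOperator *-commutativeMonoid public
    using () renaming (big< to Π<; big-cong to Π-cong; big-head to Π-head)

  Σ-*ˡ : ∀ k x (f : ℕ → Carrier) → x * Σ< k f ≈ Σ< k (λ j → x * f j)
  Σ-*ˡ zero    x f = zeroʳ x
  Σ-*ˡ (suc k) x f = trans (distribˡ x _ _) (+-cong (Σ-*ˡ k x f) refl)

-- Iterating this
-- construction gives the bivariate series ℚ[[x]][[y]] of Defs.
module PowerSeries {c ℓ} (R : CommutativeRing c ℓ) where
  open CommutativeRing R
  open RingBigOperators R
  open import Relation.Binary.Reasoning.Setoid setoid
  open import Algebra.Properties.CommutativeSemigroup +-commutativeSemigroup using (x∙yz≈y∙xz)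

  PS : Set c
  PS = ℕ → Carrier

  _≋_ : PS → PS → Set ℓ
  f ≋ g = ∀ n → f n ≈ g n

  _⊞_ : PS → PS → PS
  (f ⊞ g) n = f n + g n

  ⊟_ : PS → PS
  (⊟ f) n = - f n

  _⊠_ : PS → PS → PS
  (f ⊠ g) n = Σ< (suc n) (λ a → f a * g (n ∸ a))

  zeroPS : PS
  zeroPS n = 0#

  onePS : PS
  onePS zero    = 1#
  onePS (suc n) = 0#

  tail : PS → PS
  tail f n = f (suc n)

  -- The Cauchy product is determined by these two equations; every ring law
  -- below is proved from them by induction on the degree.
  ⊠-zero : ∀ f g → (f ⊠ g) 0 ≈ f 0 * g 0
  ⊠-zero f g = +-identityˡ _

  ⊠-suc : ∀ f g n → (f ⊠ g) (suc n) ≈ f 0 * g (suc n) + (tail f ⊠ g) n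
  ⊠-suc f g n = Σ-head (suc n) (λ a → f a * g (suc n ∸ a))

  ⊠-cong : ∀ {f f′ g g′} → f ≋ f′ → g ≋ g′ → (f ⊠ g) ≋ (f′ ⊠ g′)
  ⊠-cong f≋f′ g≋g′ n = Σ-cong (suc n) (λ a → *-cong (f≋f′ a) (g≋g′ (n ∸ a)))

  ⊠-distribʳ : ∀ h f g → ((f ⊞ g) ⊠ h) ≋ ((f ⊠ h) ⊞ (g ⊠ h))
  ⊠-distribʳ h f g n =
    trans (Σ-cong (suc n) (λ a → distribʳ (h (n ∸ a)) (f a) (g a))) (Σ-+ (suc n) _ _)

  ⊠-distribˡ : ∀ h f g → (h ⊠ (f ⊞ g)) ≋ ((h ⊠ f) ⊞ (h ⊠ g))
  ⊠-distribˡ h f g n =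
    trans (Σ-cong (suc n) (λ a → distribˡ (h a) (f (n ∸ a)) (g (n ∸ a)))) (Σ-+ (suc n) _ _)

  scale-⊠ : ∀ x f g → ((λ n → x * f n) ⊠ g) ≋ (λ n → x * (f ⊠ g) n)
  scale-⊠ x f g n =
    trans (Σ-cong (suc n) (λ a → *-assoc x (f a) (g (n ∸ a)))) (sym (Σ-*ˡ (suc n) x _))

  zero-⊠ : ∀ g → (zeroPS ⊠ g) ≋ zeroPS
  zero-⊠ g n = trans (Σ-cong (suc n) (λ a → zeroˡ (g (n ∸ a)))) (Σ-zero (suc n))

  ⊠-assoc : ∀ f g h → ((f ⊠ g) ⊠ h) ≋ (f ⊠ (g ⊠ h))
  ⊠-assoc f g h zero = begin
    ((f ⊠ g) ⊠ h) 0   ≈⟨ trans (⊠-zero (f ⊠ g) h) (*-cong (⊠-zero f g) refl) ⟩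
    f 0 * g 0 * h 0   ≈⟨ *-assoc _ _ _ ⟩
    f 0 * (g 0 * h 0) ≈⟨ sym (trans (⊠-zero f (g ⊠ h)) (*-cong refl (⊠-zero g h))) ⟩
    (f ⊠ (g ⊠ h)) 0   ∎
  ⊠-assoc f g h (suc n) = begin
    ((f ⊠ g) ⊠ h) (suc n)
      ≈⟨ ⊠-suc (f ⊠ g) h n ⟩
    (f ⊠ g) 0 * h (suc n) + (tail (f ⊠ g) ⊠ h) n
      ≈⟨ +-cong (*-cong (⊠-zero f g) refl) (⊠-cong {g = h} {g′ = h} (⊠-suc f g) (λ _ → refl) n) ⟩
    f 0 * g 0 * h (suc n) + ((f0·g′ ⊞ (tail f ⊠ g)) ⊠ h) n
      ≈⟨ +-cong refl (⊠-distribʳ h f0·g′ (tail f ⊠ g) n) ⟩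
    f 0 * g 0 * h (suc n) + ((f0·g′ ⊠ h) n + ((tail f ⊠ g) ⊠ h) n)
      ≈⟨ +-cong refl (+-cong (scale-⊠ (f 0) (tail g) h n) (⊠-assoc (tail f) g h n)) ⟩
    f 0 * g 0 * h (suc n) + (f 0 * (tail g ⊠ h) n + (tail f ⊠ (g ⊠ h)) n)
      ≈⟨ sym (+-assoc _ _ _) ⟩
    f 0 * g 0 * h (suc n) + f 0 * (tail g ⊠ h) n + (tail f ⊠ (g ⊠ h)) n
      ≈⟨ +-cong (trans (+-cong (*-assoc _ _ _) refl) (sym (distribˡ _ _ _))) refl ⟩
    f 0 * (g 0 * h (suc n) + (tail g ⊠ h) n) + (tail f ⊠ (g ⊠ h)) n
      ≈⟨ +-cong (*-cong refl (sym (⊠-suc g h n))) refl ⟩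
    f 0 * (g ⊠ h) (suc n) + (tail f ⊠ (g ⊠ h)) n
      ≈⟨ sym (⊠-suc f (g ⊠ h) n) ⟩
    (f ⊠ (g ⊠ h)) (suc n) ∎
    where
    f0·g′ : PS
    f0·g′ k = f 0 * g (suc k)

  -- commutativity peels one coefficient off each side, hence the step of two
  ⊠-comm : ∀ f g → (f ⊠ g) ≋ (g ⊠ f)
  ⊠-comm f g zero = trans (⊠-zero f g) (trans (*-comm _ _) (sym (⊠-zero g f)))
  ⊠-comm f g (suc zero) = begin
    (f ⊠ g) 1                ≈⟨ trans (⊠-suc f g 0) (+-cong refl (⊠-zero (tail f) g)) ⟩
    f 0 * g 1 + f 1 * g 0    ≈⟨ trans (+-comm _ _) (+-cong (*-comm _ _) (*-comm _ _)) ⟩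
    g 0 * f 1 + g 1 * f 0    ≈⟨ sym (trans (⊠-suc g f 0) (+-cong refl (⊠-zero (tail g) f))) ⟩
    (g ⊠ f) 1                ∎
  ⊠-comm f g (suc (suc n)) = begin
    (f ⊠ g) (2+n)
      ≈⟨ trans (⊠-suc f g (suc n)) (+-cong refl (⊠-comm (tail f) g (suc n))) ⟩
    f 0 * g (2+n) + (g ⊠ tail f) (suc n)
      ≈⟨ +-cong refl (trans (⊠-suc g (tail f) n) (+-cong refl (⊠-comm (tail g) (tail f) n))) ⟩
    f 0 * g (2+n) + (g 0 * f (2+n) + (tail f ⊠ tail g) n)
      ≈⟨ x∙yz≈y∙xz _ _ _ ⟩
    g 0 * f (2+n) + (f 0 * g (2+n) + (tail f ⊠ tail g) n)
      ≈⟨ +-cong refl (trans (sym (⊠-suc f (tail g) n)) (⊠-comm f (tail g) (suc n))) ⟩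
    g 0 * f (2+n) + (tail g ⊠ f) (suc n)
      ≈⟨ sym (⊠-suc g f (suc n)) ⟩
    (g ⊠ f) (2+n) ∎
    where
    2+n : ℕ
    2+n = suc (suc n)

  one-⊠ : ∀ f → (onePS ⊠ f) ≋ f
  one-⊠ f zero    = trans (⊠-zero onePS f) (*-identityˡ _)
  one-⊠ f (suc n) =
    trans (⊠-suc onePS f n) (trans (+-cong (*-identityˡ _) (zero-⊠ f n)) (+-identityʳ _))

  powerSeriesRing : CommutativeRing c ℓ
  powerSeriesRing = record
    { Carrier = PS
    ; _≈_ = _≋_
    ; _+_ = _⊞_
    ; _*_ = _⊠_
    ; -_ = ⊟_
    ; 0# = zeroPS
    ; 1# = onePS
    ; isCommutativeRing = record
      { isRing = record
        { +-isAbelianGroup = record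
          { isGroup = record
            { isMonoid = record
              { isSemigroup = record
                { isMagma = record
                  { isEquivalence = record
                    { refl = λ n → refl
                    ; sym = λ p n → sym (p n)
                    ; trans = λ p q n → trans (p n) (q n) }
                  ; ∙-cong = λ p q n → +-cong (p n) (q n) }
                ; assoc = λ f g h n → +-assoc (f n) (g n) (h n) }
              ; identity = (λ f n → +-identityˡ (f n)) , (λ f n → +-identityʳ (f n)) }
            ; inverse = (λ f n → -‿inverseˡ (f n)) , (λ f n → -‿inverseʳ (f n))
            ; ⁻¹-cong = λ p n → -‿cong (p n) }
          ; comm = λ f g n → +-comm (f n) (g n) }
        ; *-cong = ⊠-cong
        ; *-assoc = ⊠-assoc
        ; *-identity = one-⊠ , (λ f n → trans (⊠-comm f onePS n) (one-⊠ f n))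
        ; distrib = ⊠-distribˡ , (λ h f g → ⊠-distribʳ h f g) }
      ; *-comm = ⊠-comm }
    }

  Σ-coeff : ∀ k (F : ℕ → PS) n →
            RingBigOperators.Σ< powerSeriesRing k F n ≈ Σ< k (λ j → F j n)
  Σ-coeff zero    F n = refl
  Σ-coeff (suc k) F n = +-cong (Σ-coeff k F n) refl

  ⊠-const : ∀ u f → (∀ k → u (suc k) ≈ 0#) → ∀ n → (u ⊠ f) n ≈ u 0 * f n
  ⊠-const u f u′≈0 zero    = ⊠-zero u f
  ⊠-const u f u′≈0 (suc n) = begin
    (u ⊠ f) (suc n)                   ≈⟨ ⊠-suc u f n ⟩
    u 0 * f (suc n) + (tail u ⊠ f) n  ≈⟨ +-cong refl (trans (⊠-cong {g = f} {g′ = f} u′≈0 (λ _ → refl) n) (zero-⊠ f n)) ⟩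
    u 0 * f (suc n) + 0#              ≈⟨ +-identityʳ _ ⟩
    u 0 * f (suc n)                   ∎

  ⊠-shift-zero : ∀ u f → u 0 ≈ 0# → (u ⊠ f) 0 ≈ 0#
  ⊠-shift-zero u f u0≈0 = trans (⊠-zero u f) (trans (*-cong u0≈0 refl) (zeroˡ _))

  ⊠-shift-suc : ∀ u f → u 0 ≈ 0# → ∀ n → (u ⊠ f) (suc n) ≈ (tail u ⊠ f) n
  ⊠-shift-suc u f u0≈0 n =
    trans (⊠-suc u f n) (trans (+-cong (trans (*-cong u0≈0 refl) (zeroˡ _)) refl) (+-identityˡ _))

module FallingFactorialIdentity {c ℓ} (R : CommutativeRing c ℓ) where
  open CommutativeRing R
  open RingBigOperators R
  open import Relation.Binary.Reasoning.Setoid setoid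
  open import Algebra.Definitions.RawMonoid +-rawMonoid using (_×_)
  open import Algebra.Properties.Ring ring
    using (-0#≈0#; -‿+-comm; [y-z]x≈yx-zx; //-rightDividesˡ; //-rightDividesʳ)
  open import Algebra.Properties.CommutativeSemigroup +-commutativeSemigroup using (interchange)
  open import Algebra.Properties.CommutativeSemigroup *-commutativeSemigroup
    using (x∙yz≈y∙xz; xy∙z≈xz∙y)

  ι : ℕ → Carrier
  ι k = k × 1#

  falling : Carrier → ℕ → Carrier
  falling a k = Π< k (λ j → a - ι j)

  -- the index shift j ↦ j+1 in falling (1+a) (k+1) = (1+a) · falling a k
  shift-difference : ∀ a b → (1# + a) - (1# + b) ≈ a - b
  shift-difference a b = begin
    (1# + a) + - (1# + b)       ≈⟨ +-cong refl (sym (-‿+-comm 1# b)) ⟩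
    (1# + a) + (- 1# + - b)     ≈⟨ interchange 1# a (- 1#) (- b) ⟩
    (1# + - 1#) + (a + - b)     ≈⟨ +-cong (-‿inverseʳ 1#) refl ⟩
    0# + (a - b)                ≈⟨ +-identityˡ _ ⟩
    a - b                       ∎

  -- peeling off the factor j = 0 (stated up to ≈ so it applies to b = k+1-x-y)
  falling-suc : ∀ {a b} k → b ≈ 1# + a → falling b (suc k) ≈ b * falling a k
  falling-suc {a} {b} k b≈1+a = begin
    falling b (suc k)                               ≈⟨ Π-head k (λ j → b - ι j) ⟩
    (b - 0#) * Π< k (λ j → b - (1# + ι j))          ≈⟨ *-cong b-0≈b (Π-cong k shift) ⟩
    b * falling a k                                 ∎
    where
    b-0≈b : b - 0# ≈ b
    b-0≈b = trans (+-cong refl -0#≈0#) (+-identityʳ b)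
    shift : ∀ j → b - (1# + ι j) ≈ a - ι j
    shift j = trans (+-cong b≈1+a refl) (shift-difference a (ι j))

  Recurrence : Carrier → Carrier → (ℕ → Carrier) → Set ℓ
  Recurrence x y F = ∀ k → (ι (suc k) - x) * F k ≈ 1# + y * Σ< (suc k) F

  module _ (x y : Carrier) (F : ℕ → Carrier) (rec : Recurrence x y F) where

    -- 1 + y (F₀ + ⋯ + F_{k-1}), the factor that turns falling (k-x-y) k
    -- into falling (k-x) k
    B : ℕ → Carrier
    B k = 1# + y * Σ< k F

    B-suc : ∀ k → B (suc k) ≈ B k + y * F k
    B-suc k = trans (+-cong refl (distribˡ y (Σ< k F) (F k))) (sym (+-assoc _ _ _))

    -- subtracting y F_k from the recurrence:  (k+1-x-y) F_k = B k
    tilted : ∀ k → (ι (suc k) - x - y) * F k ≈ B k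
    tilted k = begin
      (ι (suc k) - x - y) * F k               ≈⟨ [y-z]x≈yx-zx (F k) _ y ⟩
      (ι (suc k) - x) * F k - y * F k         ≈⟨ +-cong (rec k) refl ⟩
      1# + y * Σ< (suc k) F - y * F k         ≈⟨ +-cong (B-suc k) refl ⟩
      B k + y * F k - y * F k                 ≈⟨ //-rightDividesʳ (y * F k) (B k) ⟩
      B k                                     ∎

    partial-product : ∀ k → falling (ι k - x - y) k * B k ≈ falling (ι k - x) k
    partial-product zero = begin
      1# * (1# + y * 0#)   ≈⟨ *-identityˡ _ ⟩
      1# + y * 0#          ≈⟨ +-cong refl (zeroʳ y) ⟩
      1# + 0#              ≈⟨ +-identityʳ 1# ⟩
      1#                   ∎
    partial-product (suc k) = begin
      falling L (suc k) * B (suc k)         ≈⟨ *-cong (falling-suc k L≈1+) (B-suc k) ⟩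
      (L * P) * (B k + y * F k)             ≈⟨ distribˡ (L * P) (B k) (y * F k) ⟩
      (L * P) * B k + (L * P) * (y * F k)   ≈⟨ +-cong (*-assoc L P (B k)) regroup ⟩
      L * (P * B k) + y * ((L * F k) * P)   ≈⟨ +-cong (*-cong refl IH) (*-cong refl (*-cong (tilted k) refl)) ⟩
      L * Q + y * (B k * P)                 ≈⟨ +-cong refl (*-cong refl (trans (*-comm _ _) IH)) ⟩
      L * Q + y * Q                         ≈⟨ sym (distribʳ Q L y) ⟩
      (L + y) * Q                           ≈⟨ *-cong (//-rightDividesˡ y M) refl ⟩
      M * Q                                 ≈⟨ sym (falling-suc k M≈1+) ⟩
      falling M (suc k)                     ∎
      where
      L M P Q : Carrier
      L = ι (suc k) - x - y
      M = ι (suc k) - x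
      P = falling (ι k - x - y) k
      Q = falling (ι k - x) k
      IH : P * B k ≈ Q
      IH = partial-product k
      M≈1+ : M ≈ 1# + (ι k - x)
      M≈1+ = +-assoc 1# (ι k) (- x)
      L≈1+ : L ≈ 1# + (ι k - x - y)
      L≈1+ = trans (+-cong M≈1+ refl) (+-assoc 1# (ι k - x) (- y))
      regroup : (L * P) * (y * F k) ≈ y * ((L * F k) * P)
      regroup = trans (x∙yz≈y∙xz (L * P) y (F k)) (*-cong refl (xy∙z≈xz∙y L P (F k)))

    falling-identity : ∀ i → F i * (ι (suc i) - x - y) * falling (ι i - x - y) i ≈ falling (ι i - x) i
    falling-identity i = begin
      F i * L * P      ≈⟨ *-comm _ _ ⟩
      P * (F i * L)    ≈⟨ *-cong refl (trans (*-comm _ _) (tilted i)) ⟩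
      P * B i          ≈⟨ partial-product i ⟩
      falling (ι i - x) i ∎
      where
      L P : Carrier
      L = ι (suc i) - x - y
      P = falling (ι i - x - y) i

module RationalFacts where
  open import Data.Integer as ℤ using (ℤ; +_)
  open import Data.Integer.Tactic.RingSolver using (solve-∀)
  open import Data.Rational using (ℚ; mkℚ; 1ℚ; _+_; _*_; _-_; toℚᵘ)
  open import Data.Rational.Properties
    using (normalize-coprime; *-inverseʳ; toℚᵘ-injective; toℚᵘ-homo-+; *-assoc; *-identityˡ; +-0-abelianGroup)
  import Data.Rational.Unnormalised as ℚᵘ
  import Data.Rational.Unnormalised.Properties as ℚᵘ
  import Data.Nat.Coprimality as Coprime
  open import Algebra.Properties.AbelianGroup +-0-abelianGroup using (xyx⁻¹≈y)
  open import Relation.Binary.PropositionalEquality using (refl; sym; cong; cong₂; module ≡-Reasoning)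
  open ≡-Reasoning

  nat≡mkℚ : ∀ k → nat k ≡ mkℚ (+ k) 0 (Coprime.sym (Coprime.1-coprimeTo k))
  nat≡mkℚ k = normalize-coprime (Coprime.sym (Coprime.1-coprimeTo k))

  inv1+≡mkℚ : ∀ i → inv1+ i ≡ mkℚ (+ 1) i (Coprime.1-coprimeTo (suc i))
  inv1+≡mkℚ i = normalize-coprime (Coprime.1-coprimeTo (suc i))

  nat-inverse : ∀ i → nat (suc i) * inv1+ i ≡ 1ℚ
  nat-inverse i rewrite nat≡mkℚ (suc i) | inv1+≡mkℚ i =
    *-inverseʳ (mkℚ (+ suc i) 0 (Coprime.sym (Coprime.1-coprimeTo (suc i))))

  nat-suc : ∀ k → nat (suc k) ≡ 1ℚ + nat k
  nat-suc k = toℚᵘ-injective (ℚᵘ.≃-trans unnormalised (ℚᵘ.≃-sym (toℚᵘ-homo-+ 1ℚ (nat k))))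
    where
    unnormalised : toℚᵘ (nat (suc k)) ℚᵘ.≃ (toℚᵘ 1ℚ ℚᵘ.+ toℚᵘ (nat k))
    unnormalised rewrite nat≡mkℚ (suc k) | nat≡mkℚ k = ℚᵘ.*≡* (cross-multiplied (+ k))
      where
      cross-multiplied : ∀ (a : ℤ) → (+ 1 ℤ.+ a) ℤ.* + 1 ≡ (+ 1 ℤ.* + 1 ℤ.+ a ℤ.* + 1) ℤ.* + 1
      cross-multiplied = solve-∀

  cancel-inverse : ∀ a q p r → a * q ≡ 1ℚ → a * (q * (p + r)) - p ≡ r
  cancel-inverse a q p r aq≡1 = begin
    a * (q * (p + r)) - p   ≡⟨ cong (_- p) (sym (*-assoc a q (p + r))) ⟩
    a * q * (p + r) - p     ≡⟨ cong (λ t → t * (p + r) - p) aq≡1 ⟩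
    1ℚ * (p + r) - p        ≡⟨ cong (_- p) (*-identityˡ (p + r)) ⟩
    p + r - p               ≡⟨ xyx⁻¹≈y p r ⟩
    r                       ∎

  sumLt-cong : ∀ k {f g : ℕ → ℚ} → (∀ j → f j ≡ g j) → sumLt k f ≡ sumLt k g
  sumLt-cong zero    f≡g = refl
  sumLt-cong (suc k) f≡g = cong₂ _+_ (sumLt-cong k f≡g) (f≡g k)

module BivariateSeries where
  open import Data.Rational as ℚ using (ℚ; 0ℚ; 1ℚ)
  import Data.Rational.Properties as ℚP
  open import Relation.Binary.PropositionalEquality using (refl; sym; trans; cong; module ≡-Reasoning)

  module Univariate = PowerSeries ℚP.+-*-commutativeRing
  module Bivariate  = PowerSeries Univariate.powerSeriesRing

  𝕊 : CommutativeRing _ _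
  𝕊 = Bivariate.powerSeriesRing

  open CommutativeRing 𝕊 public
    using (+-cong; *-cong; -‿cong)
    renaming (_≈_ to _≈ₛ_; _+_ to _+ₛ_; _*_ to _*ₛ_; _-_ to _-ₛ_; 1# to 1ₛ; refl to ≈-refl; sym to ≈-sym; trans to ≈-trans)
  open RingBigOperators 𝕊 public using (Σ<; Π<; Π-cong)
  open FallingFactorialIdentity 𝕊 public using (ι; falling)
  open RationalFacts using (nat-suc)
  module ℚΣ = RingBigOperators ℚP.+-*-commutativeRing

  Σ≡sumLt : ∀ k (f : ℕ → ℚ) → ℚΣ.Σ< k f ≡ sumLt k f
  Σ≡sumLt zero    f = refl
  Σ≡sumLt (suc k) f = cong (ℚ._+ f k) (Σ≡sumLt k f)

  Σ-coeff : ∀ k (F : ℕ → Series) n m → Σ< k F n m ≡ sumLt k (λ j → F j n m)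
  Σ-coeff k F n m =
    trans (Bivariate.Σ-coeff k F n m) (trans (Univariate.Σ-coeff k (λ j → F j n) m) (Σ≡sumLt k _))

  ⊛≈* : ∀ f g → (f ⊛ g) ≈ₛ (f *ₛ g)
  ⊛≈* f g n m = sym (begin
    (f *ₛ g) n m
      ≡⟨ Univariate.Σ-coeff (suc n) (λ a → Univariate._⊠_ (f a) (g (n ∸ a))) m ⟩
    ℚΣ.Σ< (suc n) (λ a → ℚΣ.Σ< (suc m) (λ b → f a b ℚ.* g (n ∸ a) (m ∸ b)))
      ≡⟨ ℚΣ.Σ-cong (suc n) (λ a → Σ≡sumLt (suc m) _) ⟩
    ℚΣ.Σ< (suc n) (λ a → sumLt (suc m) (λ b → f a b ℚ.* g (n ∸ a) (m ∸ b)))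
      ≡⟨ Σ≡sumLt (suc n) _ ⟩
    (f ⊛ g) n m ∎)
    where open ≡-Reasoning

  constS-⊛ : ∀ q f → (constS q *ₛ f) ≈ₛ scaleS q f
  constS-⊛ q f n m = trans (Bivariate.⊠-const (constS q) f (λ k m → refl) n m)
                           (Univariate.⊠-const (constS q 0) (f n) (λ k → refl) m)

  constS-1 : constS 1ℚ ≈ₛ 1ₛ
  constS-1 zero    zero    = refl
  constS-1 zero    (suc m) = refl
  constS-1 (suc n) m       = refl

  constS-1+ : ∀ q → constS (1ℚ ℚ.+ q) ≈ₛ 1ₛ +ₛ constS q
  constS-1+ q zero    zero    = refl
  constS-1+ q zero    (suc m) = refl
  constS-1+ q (suc n) m       = refl

  numeral : ∀ k → constS (nat k) ≈ₛ ι k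
  numeral zero    zero    zero    = refl
  numeral zero    zero    (suc m) = refl
  numeral zero    (suc n) m       = refl
  numeral (suc k) n m =
    trans (cong (λ q → constS q n m) (nat-suc k))
          (trans (constS-1+ (nat k) n m) (cong (ℚ._+_ (1ₛ n m)) (numeral k n m)))

  X-zero : ∀ f m → (X *ₛ f) 0 m ≡ 0ℚ
  X-zero f m = Bivariate.⊠-shift-zero X f (λ m → refl) m

  X-suc : ∀ f n m → (X *ₛ f) (suc n) m ≡ f n m
  X-suc f n m = trans (Bivariate.⊠-shift-suc X f (λ m → refl) n m)
    (trans (Bivariate.⊠-const (Bivariate.tail X) f (λ k m → refl) n m)
    (trans (Univariate.⊠-const (X 1) (f n) (λ k → refl) m) (ℚP.*-identityˡ (f n m))))

  Y-zero : ∀ f n → (Y *ₛ f) n 0 ≡ 0ℚ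
  Y-zero f n = trans (Bivariate.⊠-const Y f (λ k m → refl) n 0)
                     (Univariate.⊠-shift-zero (Y 0) (f n) refl)

  Y-suc : ∀ f n m → (Y *ₛ f) n (suc m) ≡ f n m
  Y-suc f n m = trans (Bivariate.⊠-const Y f (λ k m → refl) n (suc m))
    (trans (Univariate.⊠-shift-suc (Y 0) (f n) refl m)
    (trans (Univariate.⊠-const (Univariate.tail (Y 0)) (f n) (λ k → refl) m) (ℚP.*-identityˡ (f n m))))

  prodS≈Π : ∀ k H → prodS k H ≈ₛ Π< k H
  prodS≈Π zero    H = constS-1
  prodS≈Π (suc k) H = ≈-trans (⊛≈* (prodS k H) (H k)) (*-cong {v = H k} (prodS≈Π k H) (λ n m → refl))

  binomS≈ : ∀ {a b} i → a ≈ₛ b → binomS a i ≈ₛ (constS (invFact i) *ₛ falling b i)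
  binomS≈ {a} {b} i a≈b n m = trans
    (cong (invFact i ℚ.*_) (≈-trans (prodS≈Π i _) (Π-cong i (λ j → +-cong a≈b (-‿cong (numeral j)))) n m))
    (sym (constS-⊛ (invFact i) (falling b i) n m))

module TierRecurrence where
  open BivariateSeries
  open RationalFacts
  open import Data.Rational as ℚ using (ℚ; 0ℚ; 1ℚ)
  import Data.Rational.Properties as ℚP
  open import Algebra.Properties.Ring (CommutativeRing.ring 𝕊) using ([y-z]x≈yx-zx)
  open FallingFactorialIdentity 𝕊 using (Recurrence)
  open import Relation.Binary.PropositionalEquality using (refl; sym; trans; cong; cong₂; module ≡-Reasoning)
  open ≡-Reasoning

  g : ℕ → Series
  g k = Σ< k genF

  first-column : ∀ j m → tierRow m j 0 ≡ inv1+ j ℚ.* zetaStar1 (suc j) m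
  first-column j zero    = ℚP.*-comm 1ℚ (inv1+ j)
  first-column j (suc m) = refl

  tier-step : ∀ i n m →
    genF i n m ≡ inv1+ i ℚ.* ((X *ₛ genF i) n m ℚ.+ (1ₛ +ₛ Y *ₛ g (suc i)) n m)
  tier-step i zero zero = begin
    1ℚ ℚ.* q                 ≡⟨ ℚP.*-comm 1ℚ q ⟩
    q ℚ.* 1ℚ                 ≡⟨ cong (q ℚ.*_) (cong₂ (λ p r → p ℚ.+ (1ℚ ℚ.+ r)) (sym (X-zero (genF i) 0)) (sym (Y-zero (g (suc i)) 0))) ⟩
    q ℚ.* ((X *ₛ genF i) 0 0 ℚ.+ (1ℚ ℚ.+ (Y *ₛ g (suc i)) 0 0)) ∎
    where q = inv1+ i
  tier-step i (suc n) zero = begin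
    P ℚ.* q                  ≡⟨ ℚP.*-comm P q ⟩
    q ℚ.* P                  ≡⟨ cong (q ℚ.*_) (sym (ℚP.+-identityʳ P)) ⟩
    q ℚ.* (P ℚ.+ 0ℚ)         ≡⟨ cong (q ℚ.*_) (cong₂ (λ p r → p ℚ.+ (0ℚ ℚ.+ r)) (sym (X-suc (genF i) n 0)) (sym (Y-zero (g (suc i)) (suc n)))) ⟩
    q ℚ.* ((X *ₛ genF i) (suc n) 0 ℚ.+ (0ℚ ℚ.+ (Y *ₛ g (suc i)) (suc n) 0)) ∎
    where
    q P : ℚ
    q = inv1+ i
    P = powQ q (suc n)
  tier-step i zero (suc m) = cong (q ℚ.*_) (begin
    sumLt (suc i) (λ j → inv1+ j ℚ.* zetaStar1 (suc j) m)  ≡⟨ sumLt-cong (suc i) (λ j → sym (first-column j m)) ⟩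
    sumLt (suc i) (λ j → genF j 0 m)                     ≡⟨ sym (trans (Y-suc (g (suc i)) 0 m) (Σ-coeff (suc i) genF 0 m)) ⟩
    Yg                                                   ≡⟨ sym (ℚP.+-identityˡ Yg) ⟩
    0ℚ ℚ.+ Yg                                            ≡⟨ sym (ℚP.+-identityˡ (0ℚ ℚ.+ Yg)) ⟩
    0ℚ ℚ.+ (0ℚ ℚ.+ Yg)                                   ≡⟨ cong (ℚ._+ (0ℚ ℚ.+ Yg)) (sym (X-zero (genF i) (suc m))) ⟩
    (X *ₛ genF i) 0 (suc m) ℚ.+ (0ℚ ℚ.+ Yg)              ∎)
    where
    q Yg : ℚ
    q = inv1+ i
    Yg = (Y *ₛ g (suc i)) 0 (suc m)
  tier-step i (suc n) (suc m) = begin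
    A ℚ.* q ℚ.+ q ℚ.* S         ≡⟨ cong (ℚ._+ q ℚ.* S) (ℚP.*-comm A q) ⟩
    q ℚ.* A ℚ.+ q ℚ.* S         ≡⟨ sym (ℚP.*-distribˡ-+ q A S) ⟩
    q ℚ.* (A ℚ.+ S)             ≡⟨ cong (λ t → q ℚ.* (A ℚ.+ t)) (sym (ℚP.+-identityˡ S)) ⟩
    q ℚ.* (A ℚ.+ (0ℚ ℚ.+ S))    ≡⟨ cong (q ℚ.*_) (cong₂ (λ p r → p ℚ.+ (0ℚ ℚ.+ r)) (sym (X-suc (genF i) n (suc m))) Yg≡S) ⟩
    q ℚ.* ((X *ₛ genF i) (suc n) (suc m) ℚ.+ (0ℚ ℚ.+ (Y *ₛ g (suc i)) (suc n) (suc m))) ∎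
    where
    q A S : ℚ
    q = inv1+ i
    A = tierRow (suc m) i n
    S = sumLt (suc i) (λ j → tierRow m j (suc n))
    Yg≡S : S ≡ (Y *ₛ g (suc i)) (suc n) (suc m)
    Yg≡S = sym (trans (Y-suc (g (suc i)) (suc n) m) (Σ-coeff (suc i) genF (suc n) m))

  recurrence : Recurrence X Y genF
  recurrence k n m = begin
    ((ι (suc k) -ₛ X) *ₛ genF k) n m
      ≡⟨ *-cong {u = genF k} {v = genF k} (+-cong (≈-sym (numeral (suc k))) (λ _ _ → refl)) (λ _ _ → refl) n m ⟩
    ((constS a -ₛ X) *ₛ genF k) n m
      ≡⟨ [y-z]x≈yx-zx (genF k) (constS a) X n m ⟩
    (constS a *ₛ genF k) n m ℚ.- (X *ₛ genF k) n m
      ≡⟨ cong (ℚ._- p) (trans (constS-⊛ a (genF k) n m) (cong (a ℚ.*_) (tier-step k n m))) ⟩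
    a ℚ.* (q ℚ.* (p ℚ.+ r)) ℚ.- p
      ≡⟨ cancel-inverse a q p r (nat-inverse k) ⟩
    r ∎
    where
    a q p r : ℚ
    a = nat (suc k)
    q = inv1+ k
    p = (X *ₛ genF k) n m
    r = (1ₛ +ₛ Y *ₛ g (suc k)) n m

theorem3p5 : (i : ℕ) → (n m : ℕ) →
    (genF i ⊛ (constS (nat (suc i)) ⊖ X ⊖ Y) ⊛ binomS (constS (nat i) ⊖ X ⊖ Y) i) n m
    ≡ binomS (constS (nat i) ⊖ X) i n m
theorem3p5 i = begin
  genF i ⊛ L′ ⊛ binomS A′ i          ≈⟨ ⊛≈* (genF i ⊛ L′) (binomS A′ i) ⟩
  (genF i ⊛ L′) *ₛ binomS A′ i       ≈⟨ *-cong {u = binomS A′ i} (⊛≈* (genF i) L′) (binomS≈ i (numeral-minus-xy i)) ⟩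
  genF i *ₛ L′ *ₛ (1/i! *ₛ P)        ≈⟨ *-cong {u = 1/i! *ₛ P} (*-cong {x = genF i} ≈-refl (numeral-minus-xy (suc i))) ≈-refl ⟩
  genF i *ₛ L *ₛ (1/i! *ₛ P)         ≈⟨ x∙yz≈y∙xz (genF i *ₛ L) 1/i! P ⟩
  1/i! *ₛ (genF i *ₛ L *ₛ P)         ≈⟨ *-cong {x = 1/i!} ≈-refl (falling-identity X Y genF recurrence i) ⟩
  1/i! *ₛ falling (ι i -ₛ X) i       ≈⟨ ≈-sym (binomS≈ i (+-cong (numeral i) ≈-refl)) ⟩
  binomS (constS (nat i) ⊖ X) i      ∎
  where
  open BivariateSeries
  open TierRecurrence using (recurrence)
  open FallingFactorialIdentity 𝕊 using (falling-identity)
  open import Algebra.Properties.CommutativeSemigroup (CommutativeRing.*-commutativeSemigroup 𝕊)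
    using (x∙yz≈y∙xz)
  open import Relation.Binary.Reasoning.Setoid (CommutativeRing.setoid 𝕊)
  L′ A′ L P 1/i! : Series
  L′ = constS (nat (suc i)) ⊖ X ⊖ Y
  A′ = constS (nat i) ⊖ X ⊖ Y
  L = ι (suc i) -ₛ X -ₛ Y
  P = falling (ι i -ₛ X -ₛ Y) i
  1/i! = constS (invFact i)
  numeral-minus-xy : ∀ k → (constS (nat k) ⊖ X ⊖ Y) ≈ₛ (ι k -ₛ X -ₛ Y)
  numeral-minus-xy k = +-cong (+-cong (numeral k) ≈-refl) ≈-refl
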